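{- Let $n\ge 1$ and let $\pi_1,\dots,\pi_n$ be arbitrary (not necessarily distinct) cyclic permutations of $[2^n]$. For $i\in[2^n]$ define the binary $n$-tuple $$\Pi(T_n,i)=\big(c_{n,n}(\pi_n(i)),\,c_{n-1,n}(\pi_{n-1}(i)),\,\dots,\,c_{1,n}(\pi_1(i))\big).$$ Then the $2^n$ tuples $\Pi(T_n,1),\dots,\Pi(T_n,2^n)$ are pairwise distinct.
   Context: For a nonnegative integer $m$ and $i\ge1$, $\mathrm{bin}(m,i)$ denotes the $i$-th bit of the binary expansion of $m$, counted from the least significant bit (so $\mathrm{bin}(m,1)$ is the least significant bit, and $\mathrm{bin}(m,i)=0$ beyond the most significant bit). For $i\in[n]$, $c_{i,n}$ is the $0$-$1$ list of length $2^n$ with $c_{i,n}(j)=\mathrm{bin}(j-1,i)$ for $j\in[2^n]$. The $n$-Bit-Table $T_n$ is the $2^n\times n$ table with columns $c_{n,n},c_{n-1,n},\dots,c_{1,n}$ (so its $j$-th row is the $n$-bit binary expansion of $j-1$). A cyclic permutation of order $k\ge0$ on $[m]$ is the map $i\mapsto 1+((i+k-1)\bmod m)$. $\Pi(T_n)$ is the table obtained from $T_n$ by applying $\pi_\ell$ to the column $c_{\ell,n}$, and $\Pi(T_n,i)$ is its $i$-th row. -}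

module Defs where

open import Data.Nat using (ℕ; zero; suc; _+_; _∸_; _^_; _≤_; NonZero)
open import Data.Nat.DivMod using (_/_; _%_)
open import Data.Nat.Properties using (m^n≢0)
open import Data.Vec using (Vec; []; _∷_)

-- bin m i : the i-th bit of m counted from the least significant bit (i ≥ 1).
-- (bin m 0 is a junk value, never used.)
bin : ℕ → ℕ → ℕ
bin m zero    = 0
bin m (suc i) = (m / 2 ^ i) {{m^n≢0 2 i}} % 2

c : ℕ → ℕ → ℕ → ℕ
c i n j = bin (j ∸ 1) i

-- cyclic permutation of order k on [m] (m ≥ 1): i ↦ 1 + ((i + k - 1) mod m)
cyc : (k m : ℕ) → .{{NonZero m}} → ℕ → ℕ
cyc k m i = suc ((i + k ∸ 1) % m)

-- Π(T_n, i) for the cyclic permutations π_ℓ = cyc (ord ℓ) (2^n), ℓ ∈ [n]: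
-- the tuple (c_{n,n}(π_n i), c_{n-1,n}(π_{n-1} i), …, c_{1,n}(π_1 i)).
-- rowAux n ℓ builds the entries for columns ℓ, ℓ-1, …, 1.
rowAux : (n : ℕ) → (ℕ → ℕ) → (ℓ : ℕ) → ℕ → Vec ℕ ℓ
rowAux n ord zero    i = []
rowAux n ord (suc ℓ) i =
  c (suc ℓ) n (cyc (ord (suc ℓ)) (2 ^ n) {{m^n≢0 2 n}} i) ∷ rowAux n ord ℓ i

ΠT : (n : ℕ) → (ℕ → ℕ) → ℕ → Vec ℕ n
ΠT n ord i = rowAux n ord n i

module Submission where

-- Write the row index 1-based as i = a + 1; then the entry of Π(T_n, i) in
-- column ℓ = b + 1 is bit b of (a + k_ℓ) mod 2^n, where k_ℓ is the order of
-- the cyclic permutation π_ℓ.  Take two row indices i < j in [2^n] and write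
-- their difference 2-adically, j - i = (2q + 1)·2^b; since j - i < 2^n we have
-- b < n.  Adding an odd multiple of 2^b to a number flips its bit b, and
-- reducing modulo 2^n does not touch bit b when b < n.  Hence the two rows
-- differ in column b + 1, whatever the order k_{b+1} is.

open import Defs
open import Data.Nat using (ℕ; _≤_; _^_)
open import Data.Vec using (Vec)
open import Relation.Binary.PropositionalEquality using (_≡_; _≢_)

open import Data.Nat using (zero; suc; _+_; _*_; _<_; _≟_; NonZero; s≤s; z<s)
open import Data.Nat.Properties
open import Data.Nat.DivMod
open import Data.Nat.Divisibility using (divides)
open import Data.Nat.Induction using (<-rec)
open import Data.Vec using (_∷_)
open import Data.Vec.Properties using (∷-injectiveˡ; ∷-injectiveʳ)
open import Data.Product using (_,_; ∃; ∃₂)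
open import Data.Sum using (_⊎_; inj₁; inj₂)
open import Relation.Binary.Definitions using (tri<; tri≈; tri>)
open import Relation.Nullary using (yes; no)
open import Relation.Binary.PropositionalEquality
  using (refl; sym; trans; cong; module ≡-Reasoning)

even-or-odd : ∀ d → ∃ λ h → d ≡ 2 * h ⊎ d ≡ suc (2 * h)
even-or-odd zero = 0 , inj₁ refl
even-or-odd (suc d) with even-or-odd d
... | h , inj₁ refl = h , inj₂ refl
... | h , inj₂ refl = suc h , inj₁ (cong suc (sym (+-suc h (h + 0))))

suc-flips-parity : ∀ x → suc x % 2 ≢ x % 2
suc-flips-parity zero ()
suc-flips-parity (suc x) eq = suc-flips-parity x (sym (trans (sym (ss%2 x)) eq))
  where
  ss%2 : ∀ y → suc (suc y) % 2 ≡ y % 2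
  ss%2 y = trans (cong (_% 2) (+-comm 2 y)) ([m+n]%n≡m%n y 2)

odd-flips-parity : ∀ x q → (x + suc (2 * q)) % 2 ≢ x % 2
odd-flips-parity x q eq = suc-flips-parity x (trans (sym shift) eq)
  where
  open ≡-Reasoning
  shift : (x + suc (2 * q)) % 2 ≡ suc x % 2
  shift = begin
    (x + suc (2 * q)) % 2 ≡⟨ cong (_% 2) (+-suc x (2 * q)) ⟩
    (suc x + 2 * q) % 2   ≡⟨ cong (λ t → (suc x + t) % 2) (*-comm 2 q) ⟩
    (suc x + q * 2) % 2   ≡⟨ [m+kn]%n≡m%n (suc x) q 2 ⟩
    suc x % 2             ∎

bin-mod-2^ : ∀ m b n → b < n → bin ((m % 2 ^ n) {{m^n≢0 2 n}}) (suc b) ≡ bin m (suc b)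
bin-mod-2^ m b n b<n with m≤n⇒∃[o]m+o≡n b<n
... | k , refl = begin
    m % 2 ^ (suc b + k) / 2 ^ b % 2
      ≡⟨ cong (λ t → t / 2 ^ b % 2) (%-congʳ {o = m} split) ⟩
    m % (2 ^ suc k * 2 ^ b) / 2 ^ b % 2
      ≡⟨ cong (_% 2) (m%[n*o]/o≡m/o%n m (2 ^ suc k) (2 ^ b)) ⟩
    m / 2 ^ b % 2 ^ suc k % 2
      ≡⟨ m∣n⇒o%n%m≡o%m 2 (2 ^ suc k) (m / 2 ^ b) (divides (2 ^ k) (*-comm 2 (2 ^ k))) ⟩
    m / 2 ^ b % 2 ∎
  where
  open ≡-Reasoning
  instance
    _ = m^n≢0 2 b
    _ = m^n≢0 2 (suc k)
    _ = m^n≢0 2 (suc b + k)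
    _ = m*n≢0 (2 ^ suc k) (2 ^ b)
  split : 2 ^ (suc b + k) ≡ 2 ^ suc k * 2 ^ b
  split = trans (cong (λ e → 2 ^ suc e) (+-comm b k)) (^-distribˡ-+-* 2 (suc k) b)

bin-flip : ∀ a b q → bin (a + suc (2 * q) * 2 ^ b) (suc b) ≢ bin a (suc b)
bin-flip a b q eq = odd-flips-parity (a / 2 ^ b) q (trans (sym quotient) eq)
  where
  open ≡-Reasoning
  instance _ = m^n≢0 2 b
  quotient : (a + suc (2 * q) * 2 ^ b) / 2 ^ b % 2 ≡ (a / 2 ^ b + suc (2 * q)) % 2
  quotient = cong (_% 2) (begin
    (a + suc (2 * q) * 2 ^ b) / 2 ^ b
      ≡⟨ +-distrib-/-∣ʳ a (divides (suc (2 * q)) refl) ⟩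
    a / 2 ^ b + suc (2 * q) * 2 ^ b / 2 ^ b
      ≡⟨ cong (a / 2 ^ b +_) (m*n/n≡m (suc (2 * q)) (2 ^ b)) ⟩
    a / 2 ^ b + suc (2 * q) ∎)

bin-flip-mod-2^ : ∀ a b q n → b < n →
  bin (((a + suc (2 * q) * 2 ^ b) % 2 ^ n) {{m^n≢0 2 n}}) (suc b)
    ≢ bin ((a % 2 ^ n) {{m^n≢0 2 n}}) (suc b)
bin-flip-mod-2^ a b q n b<n eq = bin-flip a b q (begin
    bin (a + suc (2 * q) * 2 ^ b) (suc b)
      ≡⟨ sym (bin-mod-2^ (a + suc (2 * q) * 2 ^ b) b n b<n) ⟩
    bin ((a + suc (2 * q) * 2 ^ b) % 2 ^ n) (suc b)
      ≡⟨ eq ⟩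
    bin (a % 2 ^ n) (suc b)
      ≡⟨ bin-mod-2^ a b n b<n ⟩
    bin a (suc b) ∎)
  where
  open ≡-Reasoning
  instance _ = m^n≢0 2 n

OddTimesPowerOf2 : ℕ → Set
OddTimesPowerOf2 d = ∃₂ λ b q → d ≡ suc (2 * q) * 2 ^ b

two-adic : ∀ d → .{{NonZero d}} → OddTimesPowerOf2 d
two-adic = <-rec (λ d → .{{NonZero d}} → OddTimesPowerOf2 d) step
  where
  open ≡-Reasoning
  double : ∀ o p → 2 * (o * p) ≡ o * (2 * p)
  double o p = trans (sym (*-assoc 2 o p))
                     (trans (cong (_* p) (*-comm 2 o)) (*-assoc o 2 p))
  step : ∀ d → (∀ {h} → h < d → .{{NonZero h}} → OddTimesPowerOf2 h) →
         .{{NonZero d}} → OddTimesPowerOf2 d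
  step d rec with even-or-odd d
  ... | h , inj₂ refl = 0 , h , sym (*-identityʳ (suc (2 * h)))
  step .(2 * suc h) rec | suc h , inj₁ refl with rec (m<m+n (suc h) z<s)
  ... | b , q , h≡ = suc b , q , (begin
    2 * suc h                       ≡⟨ cong (2 *_) h≡ ⟩
    2 * (suc (2 * q) * 2 ^ b)       ≡⟨ double (suc (2 * q)) (2 ^ b) ⟩
    suc (2 * q) * 2 ^ suc b ∎)

2^-reflects-< : ∀ b n → 2 ^ b < 2 ^ n → b < n
2^-reflects-< b n lt = ≰⇒> (λ n≤b → <⇒≱ lt (^-monoʳ-≤ 2 n≤b))

exponent-bound-< : ∀ b q {d n} → d ≡ suc (2 * q) * 2 ^ b → d < 2 ^ n → b < n
exponent-bound-< b q {n = n} d≡ d<2^n =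
  2^-reflects-< b n (≤-<-trans (≤-trans (m≤n*m (2 ^ b) (suc (2 * q))) (≤-reflexive (sym d≡))) d<2^n)

entry : (n : ℕ) → (ℕ → ℕ) → ℕ → ℕ → ℕ
entry n ord b i = c (suc b) n (cyc (ord (suc b)) (2 ^ n) {{m^n≢0 2 n}} i)

entry-as-bit : ∀ n ord b a →
  entry n ord b (suc a) ≡ bin (((a + ord (suc b)) % 2 ^ n) {{m^n≢0 2 n}}) (suc b)
entry-as-bit n ord b a = refl

column-eq : ∀ n ord m b {i j} → b < m → rowAux n ord m i ≡ rowAux n ord m j →
            entry n ord b i ≡ entry n ord b j
column-eq n ord (suc m) b b<sm eq with b ≟ m
... | yes refl = ∷-injectiveˡ eq
... | no b≢m = column-eq n ord m b (≤∧≢⇒< (≤-pred b<sm) b≢m) (∷-injectiveʳ eq)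

-- Main step: rows 1 ≤ i < j ≤ 2^n differ in column b + 1, where b is the
-- 2-adic valuation of j - i.
rows-differ-< : ∀ n ord i j → 1 ≤ i → i < j → j ≤ 2 ^ n → ΠT n ord i ≢ ΠT n ord j
rows-differ-< n ord (suc a) j _ i<j j≤2^n eq with m≤n⇒∃[o]m+o≡n i<j
... | o , refl with two-adic (suc o)
... | b , q , d≡ = bin-flip-mod-2^ (a + k) b q n b<n (begin
    bin ((a + k + suc (2 * q) * 2 ^ b) % 2 ^ n) (suc b)
      ≡⟨ cong (λ x → bin (x % 2 ^ n) (suc b)) shuffle ⟨
    bin ((suc a + o + k) % 2 ^ n) (suc b)
      ≡⟨ entry-as-bit n ord b (suc a + o) ⟨
    entry n ord b (suc (suc a + o))
      ≡⟨ column-eq n ord n b b<n eq ⟨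
    entry n ord b (suc a)
      ≡⟨ entry-as-bit n ord b a ⟩
    bin ((a + k) % 2 ^ n) (suc b) ∎)
  where
  open ≡-Reasoning
  instance _ = m^n≢0 2 n
  k = ord (suc b)
  shuffle : suc a + o + k ≡ a + k + suc (2 * q) * 2 ^ b
  shuffle = begin
    suc a + o + k               ≡⟨ cong (_+ k) (sym (+-suc a o)) ⟩
    a + suc o + k               ≡⟨ +-assoc a (suc o) k ⟩
    a + (suc o + k)             ≡⟨ cong (a +_) (+-comm (suc o) k) ⟩
    a + (k + suc o)             ≡⟨ sym (+-assoc a k (suc o)) ⟩
    a + k + suc o               ≡⟨ cong (a + k +_) d≡ ⟩
    a + k + suc (2 * q) * 2 ^ b ∎
  -- j - i < j ≤ 2^n
  b<n : b < n
  b<n = exponent-bound-< b q d≡ (≤-trans (s≤s (s≤s (m≤n+m o a))) j≤2^n)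

theorem6 : (n : ℕ) → 1 ≤ n → (ord : ℕ → ℕ) →
    (i j : ℕ) → 1 ≤ i → i ≤ 2 ^ n → 1 ≤ j → j ≤ 2 ^ n →
    i ≢ j → ΠT n ord i ≢ ΠT n ord j
theorem6 n _ ord i j 1≤i i≤2^n 1≤j j≤2^n i≢j with <-cmp i j
... | tri< i<j _ _ = rows-differ-< n ord i j 1≤i i<j j≤2^n
... | tri≈ _ i≡j _ = λ _ → i≢j i≡j
... | tri> _ _ j<i = λ eq → rows-differ-< n ord j i 1≤j j<i i≤2^n (sym eq)
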